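{- Let $\mathtt{x}$ be a variable of type $\mathtt{list}$ and let $L$ be a simple list expression in normal form such that $\mathtt{x} \in \mathrm{Var}(L)$ and $\mathtt{x} \neq L$ (syntactically). Then the equation $\mathtt{x} = L$ has no solution, i.e. there is no substitution $\sigma$ with $\mathtt{x}\sigma =_{\mathrm{AU}} L\sigma$.
   Context: Expressions are GP label expressions built from integer constants, string constants, the constant $\mathtt{empty}$ (the empty list), variables of the pairwise disjoint types $\mathtt{int}$, $\mathtt{string}$, $\mathtt{atom}$, $\mathtt{list}$, and list concatenation $\mathtt{:}$ (the full grammar also has arithmetic, length/degree operators and string concatenation). Types form a hierarchy $\mathtt{int},\mathtt{string} < \mathtt{atom} < \mathtt{list}$ (lists of length one are identified with their entry). A simple expression contains no operators other than list concatenation $\mathtt{:}$ (no arithmetic, length, degree, unary minus or string concatenation) and at most one occurrence of a variable of type $\mathtt{list}$. An expression is normalised if the rewrite rules $L\mathtt{:}\mathtt{empty} \to L$ and $\mathtt{empty}\mathtt{:}L \to L$ have been applied exhaustively. A substitution maps integer variables to integer expressions, string variables to string expressions, atom variables to atom expressions and list variables to list expressions; $t\sigma$ denotes simultaneous replacement of variables. $=_{\mathrm{AU}}$ is the equivalence (congruence) on expressions generated by $x\mathtt{:}(y\mathtt{:}z) = (x\mathtt{:}y)\mathtt{:}z$, $\mathtt{empty}\mathtt{:}x = x$, $x\mathtt{:}\mathtt{empty} = x$ for list variables $x,y,z$. $\mathrm{Var}(L)$ is the set of variables occurring in $L$. -}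

module Defs where

open import Data.Nat using (ℕ; _≤_; _+_)
open import Data.Integer using (ℤ)
open import Data.String using (String)
open import Data.Product using (Σ; _×_)
open import Data.Empty using (⊥)
open import Data.Unit using (⊤)
open import Relation.Binary.PropositionalEquality using (_≡_)

-- GP types: int, string < atom < list
data Ty : Set where
  int string atom list : Ty

-- Variable names are natural numbers; a variable is a (type, name) pair,
-- so variables of different types are disjoint.

data Expr : Set where
  num    : ℤ → Expr
  str    : String → Expr
  empty  : Expr
  var    : Ty → ℕ → Expr
  _∶_    : Expr → Expr → Expr       -- list concatenation ':'
  plus minus times div : Expr → Expr → Expr
  neg    : Expr → Expr
  length : Expr → Expr
  indeg outdeg : ℕ → Expr           -- degree operators on node identifiers
  _·_    : Expr → Expr → Expr       -- string concatenation

infixr 5 _∶_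

data _⦂_ : Expr → Ty → Set where
  t-num    : ∀ {i} → num i ⦂ int
  t-str    : ∀ {s} → str s ⦂ string
  t-empty  : empty ⦂ list
  t-var    : ∀ {t n} → var t n ⦂ t
  t-cons   : ∀ {e f} → e ⦂ list → f ⦂ list → (e ∶ f) ⦂ list
  t-plus   : ∀ {e f} → e ⦂ int → f ⦂ int → plus e f ⦂ int
  t-minus  : ∀ {e f} → e ⦂ int → f ⦂ int → minus e f ⦂ int
  t-times  : ∀ {e f} → e ⦂ int → f ⦂ int → times e f ⦂ int
  t-div    : ∀ {e f} → e ⦂ int → f ⦂ int → div e f ⦂ int
  t-neg    : ∀ {e} → e ⦂ int → neg e ⦂ int
  t-length : ∀ {e} → e ⦂ list → length e ⦂ int
  t-indeg  : ∀ {n} → indeg n ⦂ int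
  t-outdeg : ∀ {n} → outdeg n ⦂ int
  t-conc   : ∀ {e f} → e ⦂ string → f ⦂ string → (e · f) ⦂ string
  sub-int  : ∀ {e} → e ⦂ int → e ⦂ atom
  sub-str  : ∀ {e} → e ⦂ string → e ⦂ atom
  sub-atom : ∀ {e} → e ⦂ atom → e ⦂ list

Subst : Set
Subst = Ty → ℕ → Expr

WellTyped : Subst → Set
WellTyped σ = ∀ t n → σ t n ⦂ t

_[_] : Expr → Subst → Expr
num i [ σ ] = num i
str s [ σ ] = str s
empty [ σ ] = empty
var t n [ σ ] = σ t n
(e ∶ f) [ σ ] = (e [ σ ]) ∶ (f [ σ ])
plus e f [ σ ] = plus (e [ σ ]) (f [ σ ])
minus e f [ σ ] = minus (e [ σ ]) (f [ σ ])
times e f [ σ ] = times (e [ σ ]) (f [ σ ])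
div e f [ σ ] = div (e [ σ ]) (f [ σ ])
neg e [ σ ] = neg (e [ σ ])
length e [ σ ] = length (e [ σ ])
indeg n [ σ ] = indeg n
outdeg n [ σ ] = outdeg n
(e · f) [ σ ] = (e [ σ ]) · (f [ σ ])

data _=AU_ : Expr → Expr → Set where
  au-refl  : ∀ {e} → e =AU e
  au-sym   : ∀ {e f} → e =AU f → f =AU e
  au-trans : ∀ {e f g} → e =AU f → f =AU g → e =AU g
  au-assoc : ∀ {x y z} → (x ∶ (y ∶ z)) =AU ((x ∶ y) ∶ z)
  au-unitˡ : ∀ {x} → (empty ∶ x) =AU x
  au-unitʳ : ∀ {x} → (x ∶ empty) =AU x
  c-cons   : ∀ {e e' f f'} → e =AU e' → f =AU f' → (e ∶ f) =AU (e' ∶ f')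
  c-plus   : ∀ {e e' f f'} → e =AU e' → f =AU f' → plus e f =AU plus e' f'
  c-minus  : ∀ {e e' f f'} → e =AU e' → f =AU f' → minus e f =AU minus e' f'
  c-times  : ∀ {e e' f f'} → e =AU e' → f =AU f' → times e f =AU times e' f'
  c-div    : ∀ {e e' f f'} → e =AU e' → f =AU f' → div e f =AU div e' f'
  c-neg    : ∀ {e e'} → e =AU e' → neg e =AU neg e'
  c-length : ∀ {e e'} → e =AU e' → length e =AU length e'
  c-conc   : ∀ {e e' f f'} → e =AU e' → f =AU f' → (e · f) =AU (e' · f')

data ConcatOnly : Expr → Set where
  co-num   : ∀ {i} → ConcatOnly (num i)
  co-str   : ∀ {s} → ConcatOnly (str s)
  co-empty : ConcatOnly empty
  co-var   : ∀ {t n} → ConcatOnly (var t n)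
  co-cons  : ∀ {e f} → ConcatOnly e → ConcatOnly f → ConcatOnly (e ∶ f)

listVarOccs : Expr → ℕ
listVarOccs (num i) = 0
listVarOccs (str s) = 0
listVarOccs empty = 0
listVarOccs (var list n) = 1
listVarOccs (var _ n) = 0
listVarOccs (e ∶ f) = listVarOccs e + listVarOccs f
listVarOccs (plus e f) = listVarOccs e + listVarOccs f
listVarOccs (minus e f) = listVarOccs e + listVarOccs f
listVarOccs (times e f) = listVarOccs e + listVarOccs f
listVarOccs (div e f) = listVarOccs e + listVarOccs f
listVarOccs (neg e) = listVarOccs e
listVarOccs (length e) = listVarOccs e
listVarOccs (indeg n) = 0
listVarOccs (outdeg n) = 0
listVarOccs (e · f) = listVarOccs e + listVarOccs f

Simple : Expr → Set
Simple e = ConcatOnly e × listVarOccs e ≤ 1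

_≢empty : Expr → Set
e ≢empty = e ≡ empty → ⊥

-- normal form w.r.t. L:empty → L and empty:L → L
data Normalised : Expr → Set where
  n-num    : ∀ {i} → Normalised (num i)
  n-str    : ∀ {s} → Normalised (str s)
  n-empty  : Normalised empty
  n-var    : ∀ {t n} → Normalised (var t n)
  n-cons   : ∀ {e f} → e ≢empty → f ≢empty → Normalised e → Normalised f → Normalised (e ∶ f)
  n-plus   : ∀ {e f} → Normalised e → Normalised f → Normalised (plus e f)
  n-minus  : ∀ {e f} → Normalised e → Normalised f → Normalised (minus e f)
  n-times  : ∀ {e f} → Normalised e → Normalised f → Normalised (times e f)
  n-div    : ∀ {e f} → Normalised e → Normalised f → Normalised (div e f)
  n-neg    : ∀ {e} → Normalised e → Normalised (neg e)
  n-length : ∀ {e} → Normalised e → Normalised (length e)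
  n-indeg  : ∀ {n} → Normalised (indeg n)
  n-outdeg : ∀ {n} → Normalised (outdeg n)
  n-conc   : ∀ {e f} → Normalised e → Normalised f → Normalised (e · f)

data Occurs (t : Ty) (n : ℕ) : Expr → Set where
  here   : Occurs t n (var t n)
  consˡ  : ∀ {e f} → Occurs t n e → Occurs t n (e ∶ f)
  consʳ  : ∀ {e f} → Occurs t n f → Occurs t n (e ∶ f)
  plusˡ  : ∀ {e f} → Occurs t n e → Occurs t n (plus e f)
  plusʳ  : ∀ {e f} → Occurs t n f → Occurs t n (plus e f)
  minusˡ : ∀ {e f} → Occurs t n e → Occurs t n (minus e f)
  minusʳ : ∀ {e f} → Occurs t n f → Occurs t n (minus e f)
  timesˡ : ∀ {e f} → Occurs t n e → Occurs t n (times e f)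
  timesʳ : ∀ {e f} → Occurs t n f → Occurs t n (times e f)
  divˡ   : ∀ {e f} → Occurs t n e → Occurs t n (div e f)
  divʳ   : ∀ {e f} → Occurs t n f → Occurs t n (div e f)
  negᵒ   : ∀ {e} → Occurs t n e → Occurs t n (neg e)
  lengthᵒ : ∀ {e} → Occurs t n e → Occurs t n (length e)
  concˡ  : ∀ {e f} → Occurs t n e → Occurs t n (e · f)
  concʳ  : ∀ {e f} → Occurs t n f → Occurs t n (e · f)

-- Count the atoms of an expression, i.e. its length as a list. This measure is
-- invariant under =AU, and a well-typed substitution sends every non-list
-- variable to a single atom. Writing L = e : f with x occurring in e, the other
-- side f contains no list variable (L is simple), so f σ has as many atoms as f,
-- which is at least one since L is normalised. Hence L σ is strictly longer than
-- x σ, which occurs in e σ.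
module Submission where

open import Defs
open import Data.Nat using (ℕ; _+_; _≤_; _<_; s≤s; z≤n)
open import Data.Nat.Properties
open import Data.Product using (Σ; _×_; _,_)
open import Data.Empty using (⊥-elim)
open import Relation.Nullary using (¬_)
open import Relation.Binary.PropositionalEquality
  using (_≢_; _≡_; refl; sym; trans; cong₂)

listLength : Expr → ℕ
listLength empty = 0
listLength (e ∶ f) = listLength e + listLength f
listLength _ = 1

listLength-resp-AU : ∀ {e f} → e =AU f → listLength e ≡ listLength f
listLength-resp-AU au-refl = refl
listLength-resp-AU (au-sym p) = sym (listLength-resp-AU p)
listLength-resp-AU (au-trans p q) = trans (listLength-resp-AU p) (listLength-resp-AU q)
listLength-resp-AU (au-assoc {x} {y} {z}) = sym (+-assoc (listLength x) (listLength y) (listLength z))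
listLength-resp-AU au-unitˡ = refl
listLength-resp-AU (au-unitʳ {x}) = +-identityʳ (listLength x)
listLength-resp-AU (c-cons p q) = cong₂ _+_ (listLength-resp-AU p) (listLength-resp-AU q)
listLength-resp-AU (c-plus _ _) = refl
listLength-resp-AU (c-minus _ _) = refl
listLength-resp-AU (c-times _ _) = refl
listLength-resp-AU (c-div _ _) = refl
listLength-resp-AU (c-neg _) = refl
listLength-resp-AU (c-length _) = refl
listLength-resp-AU (c-conc _ _) = refl

listLength-nonList : ∀ {e t} → e ⦂ t → t ≢ list → listLength e ≡ 1
listLength-nonList t-num _ = refl
listLength-nonList t-str _ = refl
listLength-nonList t-empty t≢list = ⊥-elim (t≢list refl)
listLength-nonList t-var _ = refl
listLength-nonList (t-cons _ _) t≢list = ⊥-elim (t≢list refl)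
listLength-nonList (t-plus _ _) _ = refl
listLength-nonList (t-minus _ _) _ = refl
listLength-nonList (t-times _ _) _ = refl
listLength-nonList (t-div _ _) _ = refl
listLength-nonList (t-neg _) _ = refl
listLength-nonList (t-length _) _ = refl
listLength-nonList t-indeg _ = refl
listLength-nonList t-outdeg _ = refl
listLength-nonList (t-conc _ _) _ = refl
listLength-nonList (sub-int p) _ = listLength-nonList p (λ ())
listLength-nonList (sub-str p) _ = listLength-nonList p (λ ())
listLength-nonList (sub-atom _) t≢list = ⊥-elim (t≢list refl)

listLength-subst : ∀ {e σ} → WellTyped σ → ConcatOnly e → listVarOccs e ≡ 0 →
                   listLength (e [ σ ]) ≡ listLength e
listLength-subst _ co-num _ = refl
listLength-subst _ co-str _ = refl
listLength-subst _ co-empty _ = refl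
listLength-subst wt (co-var {int} {n}) _ = listLength-nonList (wt int n) (λ ())
listLength-subst wt (co-var {string} {n}) _ = listLength-nonList (wt string n) (λ ())
listLength-subst wt (co-var {atom} {n}) _ = listLength-nonList (wt atom n) (λ ())
listLength-subst wt (co-cons {e} ce cf) occs≡0 =
  cong₂ _+_ (listLength-subst wt ce (m+n≡0⇒m≡0 (listVarOccs e) occs≡0))
            (listLength-subst wt cf (m+n≡0⇒n≡0 (listVarOccs e) occs≡0))

listLength-pos : ∀ {e} → ConcatOnly e → Normalised e → e ≢ empty → 0 < listLength e
listLength-pos co-num _ _ = s≤s z≤n
listLength-pos co-str _ _ = s≤s z≤n
listLength-pos co-empty _ e≢empty = ⊥-elim (e≢empty refl)
listLength-pos co-var _ _ = s≤s z≤n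
listLength-pos (co-cons ce _) (n-cons e≢empty _ ne _) _ =
  m≤n⇒m≤n+o _ (listLength-pos ce ne e≢empty)

listLength-occurs-≤ : ∀ {x e σ} → Occurs list x e → ConcatOnly e →
                      listLength (σ list x) ≤ listLength (e [ σ ])
listLength-occurs-≤ here _ = ≤-refl
listLength-occurs-≤ (consˡ o) (co-cons ce _) = m≤n⇒m≤n+o _ (listLength-occurs-≤ o ce)
listLength-occurs-≤ (consʳ o) (co-cons _ cf) = m≤n⇒m≤o+n _ (listLength-occurs-≤ o cf)

occurs⇒listVarOccs-pos : ∀ {x e} → Occurs list x e → ConcatOnly e → 0 < listVarOccs e
occurs⇒listVarOccs-pos here _ = ≤-refl
occurs⇒listVarOccs-pos (consˡ o) (co-cons ce _) = m≤n⇒m≤n+o _ (occurs⇒listVarOccs-pos o ce)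
occurs⇒listVarOccs-pos (consʳ o) (co-cons _ cf) = m≤n⇒m≤o+n _ (occurs⇒listVarOccs-pos o cf)

0<m⇒m+n≤1⇒n≡0 : ∀ {m n} → 0 < m → m + n ≤ 1 → n ≡ 0
0<m⇒m+n≤1⇒n≡0 {n = n} 0<m m+n≤1 = n≤0⇒n≡0 (+-cancelˡ-≤ 1 _ _ (≤-trans (+-monoˡ-≤ n 0<m) m+n≤1))

solution-shorter : ∀ {x e f σ} → WellTyped σ → Occurs list x e → ConcatOnly e →
                   ConcatOnly f → Normalised f → f ≢ empty → listVarOccs e + listVarOccs f ≤ 1 →
                   listLength (σ list x) < listLength (e [ σ ]) + listLength (f [ σ ])
solution-shorter {e = e} {f} {σ} wt o ce cf nf f≢empty occs≤1 =
  ≤-<-trans (listLength-occurs-≤ o ce) (m<m+n (listLength (e [ σ ])) 0<|fσ|)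
  where
  f-occs≡0 : listVarOccs f ≡ 0
  f-occs≡0 = 0<m⇒m+n≤1⇒n≡0 (occurs⇒listVarOccs-pos o ce) occs≤1

  0<|fσ| : 0 < listLength (f [ σ ])
  0<|fσ| rewrite listLength-subst wt cf f-occs≡0 = listLength-pos cf nf f≢empty

lemma1 : (x : ℕ) (L : Expr) → L ⦂ list → Simple L → Normalised L →
    Occurs list x L → L ≢ var list x →
    ¬ (Σ Subst (λ σ → WellTyped σ × ((var list x [ σ ]) =AU (L [ σ ]))))
lemma1 x .(var list x) _ _ _ here L≢x _ = L≢x refl
lemma1 x (e ∶ f) _ (co-cons ce cf , occs≤1) (n-cons _ f≢empty _ nf) (consˡ o) _ (σ , wt , x≈L) =
  <-irrefl (listLength-resp-AU x≈L) (solution-shorter wt o ce cf nf f≢empty occs≤1)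
lemma1 x (e ∶ f) _ (co-cons ce cf , occs≤1) (n-cons e≢empty _ ne _) (consʳ o) _ (σ , wt , x≈L) =
  <-irrefl (trans (listLength-resp-AU x≈L) (+-comm (listLength (e [ σ ])) _))
           (solution-shorter wt o cf ce ne e≢empty
             (≤-trans (≤-reflexive (+-comm (listVarOccs f) (listVarOccs e))) occs≤1))
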